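{- Let $k\geq 2$. For all $n\geq 0$, $$|S_n(132,213,(k,k-1,\dots,2,1))|=\sum_{j=0}^{k-2}\binom{n-1}{j}.$$
   Context: Permutations are written in one-line notation; $S_n$ is the set of permutations of $\{1,\dots,n\}$, $S_0$ consists of the empty permutation. A permutation $\alpha\in S_n$ contains a pattern $\beta$ if some subsequence of $\alpha$ is order-isomorphic to $\beta$; otherwise it avoids $\beta$. $S_n(\beta^1,\dots,\beta^s)$ is the set of permutations in $S_n$ avoiding each $\beta^i$. Binomial coefficients use the convention $\binom{ -1}{0}=1$ and $\binom{ -1}{j}=0$ for $j\geq 1$, and $\binom{a}{j}=0$ for $0\leq a<j$. -}

module Defs where

open import Data.Nat using (ℕ; zero; suc; _<_; _∸_)
open import Data.Nat.Combinatorics using (_C_)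
open import Data.List using (List; []; _∷_; length; lookup; map; upTo; downFrom)
open import Data.Nat.ListAction using (sum)
open import Data.List.Relation.Binary.Permutation.Propositional using (_↭_)
open import Data.List.Relation.Binary.Sublist.Propositional using (_⊆_)
open import Data.Fin using (Fin; cast)
open import Data.Product using (Σ; ∃; _×_)
open import Function.Bundles using (_⇔_)
open import Relation.Binary.PropositionalEquality using (_≡_)
open import Relation.Nullary using (¬_)

-- a permutation in one-line notation is a list of naturals;
-- α ∈ S_n  iff  α is a rearrangement of [1, 2, ..., n]
IsPerm : ℕ → List ℕ → Set
IsPerm n α = α ↭ map suc (upTo n)

OrderIso : List ℕ → List ℕ → Set
OrderIso s t = Σ (length s ≡ length t) λ eq →
  ∀ (i j : Fin (length s)) →
    (lookup s i < lookup s j) ⇔ (lookup t (cast eq i) < lookup t (cast eq j))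

Contains : List ℕ → List ℕ → Set
Contains α β = ∃ λ σ → σ ⊆ α × OrderIso σ β

Avoids : List ℕ → List ℕ → Set
Avoids α β = ¬ Contains α β

p132 : List ℕ
p132 = 1 ∷ 3 ∷ 2 ∷ []

p213 : List ℕ
p213 = 2 ∷ 1 ∷ 3 ∷ []

decPat : ℕ → List ℕ
decPat k = map suc (downFrom k)

InClass : ℕ → ℕ → List ℕ → Set
InClass k n α = IsPerm n α × Avoids α p132 × Avoids α p213 × Avoids α (decPat k)

-- binom n j = (n-1 choose j), with (-1 choose 0) = 1, (-1 choose j) = 0 for j ≥ 1
binomPred : ℕ → ℕ → ℕ
binomPred zero zero = 1
binomPred zero (suc j) = 0
binomPred (suc m) j = m C j

rhs : ℕ → ℕ → ℕ
rhs k n = sum (map (binomPred n) (upTo (k ∸ 1)))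

-- If α ∈ S_n avoids 132 and 213 and starts with t+1, then avoiding 213 puts every entry larger
-- than t+1 before every smaller one, and avoiding 132 makes the larger entries increase; so α is
-- the block t+1, t+2, …, n followed by a permutation of 1, …, t of the same kind. Thus the class
-- consists of the sequences of increasing blocks of consecutive values with the blocks in
-- decreasing order, and a decreasing subsequence meets each block at most once: avoiding
-- (k, …, 1) means having at most k−1 blocks, i.e. the permutations are the compositions of n into
-- at most k−1 parts. Counting by the first block, the number c(n, m) of such permutations with at
-- most m blocks satisfies c(n+1, m+1) = Σ_{t ≤ n} c(t, m), and by Pascal's rule so do the partial
-- sums Σ_{j < m} C(n−1, j).

module Submission where

open import Defs
open import Algebra.Properties.CommutativeSemigroup using (interchange)
open import Data.Empty using (⊥; ⊥-elim)
open import Data.Maybe using (just)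
open import Data.Maybe.Properties using (just-injective)
open import Data.Fin using (Fin; toℕ; cast) renaming (zero to fzero; suc to fsuc)
open import Data.Fin.Properties using (toℕ-cast; toℕ-injective)
open import Data.List
  using (List; []; _∷_; _++_; [_]; length; lookup; map; applyUpTo; upTo; downFrom; filter; head)
open import Data.List.Properties
  using ( length-map; length-downFrom; length-++; ++-identityʳ; ++-cancelˡ; map-++; applyUpTo-∷ʳ
        ; map-applyUpTo; filter-++; filter-all; filter-none; tabulate-lookup)
open import Data.List.Membership.Propositional using (_∈_)
open import Data.List.Membership.Propositional.Properties
  using (∈-++⁻; ∈-++⁺ˡ; ∈-++⁺ʳ; ∈-map⁻; ∈-map⁺; ∈-lookup)
open import Data.List.Relation.Unary.All as All using (All; []; _∷_)
open import Data.List.Relation.Unary.All.Properties using (tabulate⁺) renaming (map⁺ to All-map⁺)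
open import Data.List.Relation.Unary.AllPairs as AllPairs using (AllPairs; []; _∷_)
open import Data.List.Relation.Unary.Any using (here)
open import Data.List.Relation.Unary.Unique.Propositional using (Unique)
import Data.List.Relation.Unary.Unique.Propositional.Properties as Unique
open import Data.List.Relation.Unary.Sorted.TotalOrder using (Sorted)
open import Data.List.Relation.Unary.Sorted.TotalOrder.Properties using (↗↭↗⇒≋; AllPairs⇒Sorted)
open import Data.List.Relation.Binary.Equality.Propositional using (≋⇒≡)
open import Data.List.Relation.Binary.Sublist.Propositional
  using (_⊆_; []; _∷_; _∷ʳ_; ⊆-refl; ⊆-trans; from∈; minimum)
open import Data.List.Relation.Binary.Sublist.Propositional.Properties using (All-resp-⊆; ∷ˡ⁻)
  renaming (++⁺ˡ to ⊆-++⁺ˡ; ++⁺ʳ to ⊆-++⁺ʳ)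
open import Data.List.Relation.Binary.Permutation.Propositional
  using (_↭_; ↭-refl; ↭-sym; ↭-trans; ↭⇒↭ₛ)
open import Data.List.Relation.Binary.Permutation.Propositional.Properties
  using (All-resp-↭; ↭-empty-inv; ¬x∷xs↭[]; ++-comm; filter-↭) renaming (++⁺ˡ to ↭-++⁺ˡ)
import Data.List.Relation.Binary.Permutation.Setoid.Properties as Permutationₛ
open import Data.Nat using (ℕ; zero; suc; _+_; _∸_; _≤_; _<_; _>_; _≥_; z≤n; s≤s; s≤s⁻¹; _<?_)
open import Data.Nat.Combinatorics using (_C_; nCk+nC[k+1]≡[n+1]C[k+1])
open import Data.Nat.ListAction using (sum)
open import Data.Nat.ListAction.Properties using (sum-++)
open import Data.Nat.Properties
open import Data.Product using (∃; ∃₂; _×_; _,_)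
open import Data.Sum using (_⊎_; inj₁; inj₂)
open import Function using (_∘_)
open import Function.Bundles using (_⇔_; mk⇔; Equivalence)
open import Function.Construct.Composition using (_⇔-∘_)
open import Function.Construct.Identity using (⇔-id)
open import Function.Construct.Symmetry using (⇔-sym)
open import Level using (Level)
open import Relation.Binary.Core using (Rel)
open import Relation.Binary.Definitions using (tri<; tri≈; tri>)
open import Relation.Binary.PropositionalEquality
  using (_≡_; _≢_; refl; sym; trans; cong; cong₂; subst; subst₂; ≢-sym; setoid; module ≡-Reasoning)
open import Relation.Nullary using (¬_; ¬?)
open import Relation.Nullary.Decidable using (from-yes)
open import Relation.Unary using (Pred; Decidable; ∁)

private variable
  ℓ : Level
  A : Set

⊆-++-split : ∀ (xs : List A) {ys σ} → σ ⊆ xs ++ ys →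
  ∃₂ λ σ₁ σ₂ → σ ≡ σ₁ ++ σ₂ × σ₁ ⊆ xs × σ₂ ⊆ ys
⊆-++-split [] σ⊆ = [] , _ , refl , minimum _ , σ⊆
⊆-++-split (x ∷ xs) (.x ∷ʳ σ⊆) with ⊆-++-split xs σ⊆
... | σ₁ , σ₂ , refl , σ₁⊆ , σ₂⊆ = σ₁ , σ₂ , refl , x ∷ʳ σ₁⊆ , σ₂⊆
⊆-++-split (x ∷ xs) (refl ∷ σ⊆) with ⊆-++-split xs σ⊆
... | σ₁ , σ₂ , refl , σ₁⊆ , σ₂⊆ = x ∷ σ₁ , σ₂ , refl , refl ∷ σ₁⊆ , σ₂⊆

AllPairs-resp-⊆ : ∀ {R : Rel A ℓ} {xs ys} → xs ⊆ ys → AllPairs R ys → AllPairs R xs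
AllPairs-resp-⊆ []           []         = []
AllPairs-resp-⊆ (y ∷ʳ xs⊆)   (_ ∷ ys↑)  = AllPairs-resp-⊆ xs⊆ ys↑
AllPairs-resp-⊆ (refl ∷ xs⊆) (y↑ ∷ ys↑) = All-resp-⊆ xs⊆ y↑ ∷ AllPairs-resp-⊆ xs⊆ ys↑

AllPairs-lookup : ∀ {R : Rel A ℓ} {xs} → AllPairs R xs →
  ∀ (i j : Fin (length xs)) → toℕ i < toℕ j → R (lookup xs i) (lookup xs j)
AllPairs-lookup (x↑ ∷ xs↑) fzero    (fsuc j) _         = All.lookup x↑ (∈-lookup j)
AllPairs-lookup (x↑ ∷ xs↑) (fsuc i) (fsuc j) (s≤s i<j) = AllPairs-lookup xs↑ i j i<j

AllPairs-tabulate : ∀ {R : Rel A ℓ} xs →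
  (∀ (i j : Fin (length xs)) → toℕ i < toℕ j → R (lookup xs i) (lookup xs j)) → AllPairs R xs
AllPairs-tabulate []       R↑ = []
AllPairs-tabulate (x ∷ xs) R↑ =
  subst (All _) (tabulate-lookup xs) (tabulate⁺ λ j → R↑ fzero (fsuc j) (s≤s z≤n)) ∷
  AllPairs-tabulate xs λ i j i<j → R↑ (fsuc i) (fsuc j) (s≤s i<j)

Unique-resp-↭ : ∀ {xs ys : List A} → xs ↭ ys → Unique xs → Unique ys
Unique-resp-↭ xs↭ys = Permutationₛ.Unique-resp-↭ (setoid _) (↭⇒↭ₛ xs↭ys)

↭-increasing⇒≡ : ∀ {xs ys} → AllPairs _<_ xs → AllPairs _<_ ys → xs ↭ ys → xs ≡ ys
↭-increasing⇒≡ xs↑ ys↑ xs↭ys = ≋⇒≡ (↗↭↗⇒≋ ≤-totalOrder (sorted xs↑) (sorted ys↑) (↭⇒↭ₛ xs↭ys))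
  where
  sorted : ∀ {zs} → AllPairs _<_ zs → Sorted ≤-totalOrder zs
  sorted zs↑ = AllPairs⇒Sorted ≤-totalOrder (AllPairs.map <⇒≤ zs↑)

↭-partition : ∀ {P : Pred A ℓ} (P? : Decidable P) {xs ys us vs} →
  All P xs → All (∁ P) ys → All P us → All (∁ P) vs →
  xs ++ ys ↭ us ++ vs → xs ↭ us × ys ↭ vs
↭-partition {P = P} P? Pxs ¬Pys Pus ¬Pvs xsys↭usvs =
  subst₂ _↭_ (keep Pxs ¬Pys) (keep Pus ¬Pvs) (filter-↭ P? xsys↭usvs) ,
  subst₂ _↭_ (drop Pxs ¬Pys) (drop Pus ¬Pvs) (filter-↭ (¬? ∘ P?) xsys↭usvs)
  where
  keep : ∀ {as bs} → All P as → All (∁ P) bs → filter P? (as ++ bs) ≡ as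
  keep {as} {bs} Pas ¬Pbs = begin
    filter P? (as ++ bs)          ≡⟨ filter-++ P? as bs ⟩
    filter P? as ++ filter P? bs  ≡⟨ cong₂ _++_ (filter-all P? Pas) (filter-none P? ¬Pbs) ⟩
    as ++ []                      ≡⟨ ++-identityʳ as ⟩
    as                            ∎
    where open ≡-Reasoning
  drop : ∀ {as bs} → All P as → All (∁ P) bs → filter (¬? ∘ P?) (as ++ bs) ≡ bs
  drop {as} {bs} Pas ¬Pbs = begin
    filter (¬? ∘ P?) (as ++ bs)                  ≡⟨ filter-++ (¬? ∘ P?) as bs ⟩
    filter (¬? ∘ P?) as ++ filter (¬? ∘ P?) bs  ≡⟨ cong₂ _++_ (filter-none (¬? ∘ P?) (All.map (λ p ¬p → ¬p p) Pas))
                                                              (filter-all (¬? ∘ P?) ¬Pbs) ⟩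
    bs                                          ∎
    where open ≡-Reasoning

block : ℕ → ℕ → List ℕ
block a zero    = []
block a (suc s) = suc a ∷ block (suc a) s

block-lower : ∀ a s → All (a <_) (block a s)
block-lower a zero    = []
block-lower a (suc s) = ≤-refl ∷ All.map (<-trans (n<1+n a)) (block-lower (suc a) s)

block-upper : ∀ a s → All (_≤ a + s) (block a s)
block-upper a zero    = []
block-upper a (suc s) = subst (λ b → All (_≤ b) (block a (suc s))) (sym (+-suc a s))
  (s≤s (m≤m+n a s) ∷ block-upper (suc a) s)

block-increasing : ∀ a s → AllPairs _<_ (block a s)
block-increasing a zero    = []
block-increasing a (suc s) = block-lower (suc a) s ∷ block-increasing (suc a) s

block-unique : ∀ a s → Unique (block a s)
block-unique a s = AllPairs.map <⇒≢ (block-increasing a s)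

block-++ : ∀ a m n → block a (m + n) ≡ block a m ++ block (a + m) n
block-++ a zero    n = cong (λ b → block b n) (sym (+-identityʳ a))
block-++ a (suc m) n = cong (suc a ∷_) (trans (block-++ (suc a) m n)
                                               (cong (λ b → block (suc a) m ++ block b n) (sym (+-suc a m))))

block-split-↭ : ∀ {t n} → t ≤ n → block t (n ∸ t) ++ block 0 t ↭ block 0 n
block-split-↭ {t} {n} t≤n = subst (block t (n ∸ t) ++ block 0 t ↭_)
  (trans (sym (block-++ 0 t (n ∸ t))) (cong (block 0) (m+[n∸m]≡n t≤n)))
  (++-comm (block t (n ∸ t)) (block 0 t))

map-suc-upTo : ∀ n → map suc (upTo n) ≡ block 0 n
map-suc-upTo n = trans (map-applyUpTo (λ i → i) suc n) (applyUpTo-block suc 0 n λ _ → refl)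
  where
  applyUpTo-block : ∀ f a n → (∀ i → f i ≡ suc (a + i)) → applyUpTo f n ≡ block a n
  applyUpTo-block f a zero    f≗ = refl
  applyUpTo-block f a (suc n) f≗ = cong₂ _∷_ (trans (f≗ 0) (cong suc (+-identityʳ a)))
    (applyUpTo-block (f ∘ suc) (suc a) n λ i → trans (f≗ (suc i)) (cong suc (+-suc a i)))

Concordant : ℕ → ℕ → ℕ → ℕ → Set
Concordant x₁ x₂ y₁ y₂ = (x₁ < x₂ × y₁ < y₂) ⊎ (x₂ < x₁ × y₂ < y₁)

concordant-sym : ∀ {x₁ x₂ y₁ y₂} → Concordant x₁ x₂ y₁ y₂ → Concordant x₂ x₁ y₂ y₁
concordant-sym (inj₁ (x₁<x₂ , y₁<y₂)) = inj₂ (x₁<x₂ , y₁<y₂)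
concordant-sym (inj₂ (x₂<x₁ , y₂<y₁)) = inj₁ (x₂<x₁ , y₂<y₁)

concordant⇒⇔ : ∀ {x₁ x₂ y₁ y₂} → Concordant x₁ x₂ y₁ y₂ → (x₁ < x₂) ⇔ (y₁ < y₂)
concordant⇒⇔ (inj₁ (x₁<x₂ , y₁<y₂)) = mk⇔ (λ _ → y₁<y₂) (λ _ → x₁<x₂)
concordant⇒⇔ (inj₂ (x₂<x₁ , y₂<y₁)) = mk⇔ (⊥-elim ∘ <-asym x₂<x₁) (⊥-elim ∘ <-asym y₂<y₁)

orderIso₃ : ∀ {x₁ x₂ x₃ y₁ y₂ y₃} →
  Concordant x₁ x₂ y₁ y₂ → Concordant x₁ x₃ y₁ y₃ → Concordant x₂ x₃ y₂ y₃ →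
  OrderIso (x₁ ∷ x₂ ∷ x₃ ∷ []) (y₁ ∷ y₂ ∷ y₃ ∷ [])
orderIso₃ {x₁} {x₂} {x₃} {y₁} {y₂} {y₃} c₁₂ c₁₃ c₂₃ = refl , iso
  where
  xs ys : List ℕ
  xs = x₁ ∷ x₂ ∷ x₃ ∷ []
  ys = y₁ ∷ y₂ ∷ y₃ ∷ []
  irrefl⇔ : ∀ {x y} → (x < x) ⇔ (y < y)
  irrefl⇔ = mk⇔ (⊥-elim ∘ <-irrefl refl) (⊥-elim ∘ <-irrefl refl)
  iso : ∀ (i j : Fin 3) → (lookup xs i < lookup xs j) ⇔ (lookup ys (cast refl i) < lookup ys (cast refl j))
  iso fzero               fzero               = irrefl⇔
  iso fzero               (fsuc fzero)        = concordant⇒⇔ c₁₂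
  iso fzero               (fsuc (fsuc fzero)) = concordant⇒⇔ c₁₃
  iso (fsuc fzero)        fzero               = concordant⇒⇔ (concordant-sym c₁₂)
  iso (fsuc fzero)        (fsuc fzero)        = irrefl⇔
  iso (fsuc fzero)        (fsuc (fsuc fzero)) = concordant⇒⇔ c₂₃
  iso (fsuc (fsuc fzero)) fzero               = concordant⇒⇔ (concordant-sym c₁₃)
  iso (fsuc (fsuc fzero)) (fsuc fzero)        = concordant⇒⇔ (concordant-sym c₂₃)
  iso (fsuc (fsuc fzero)) (fsuc (fsuc fzero)) = irrefl⇔

Has132 : List ℕ → Set
Has132 α = ∃₂ λ a b → ∃ λ c → (a ∷ b ∷ c ∷ []) ⊆ α × a < c × c < b

Has213 : List ℕ → Set
Has213 α = ∃₂ λ a b → ∃ λ c → (a ∷ b ∷ c ∷ []) ⊆ α × b < a × a < c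

HasDecreasing : ℕ → List ℕ → Set
HasDecreasing k α = ∃ λ σ → σ ⊆ α × AllPairs _>_ σ × length σ ≡ k

Has132-mono : ∀ {xs ys} → xs ⊆ ys → Has132 xs → Has132 ys
Has132-mono xs⊆ys (a , b , c , abc⊆ , ineqs) = a , b , c , ⊆-trans abc⊆ xs⊆ys , ineqs

Has213-mono : ∀ {xs ys} → xs ⊆ ys → Has213 xs → Has213 ys
Has213-mono xs⊆ys (a , b , c , abc⊆ , ineqs) = a , b , c , ⊆-trans abc⊆ xs⊆ys , ineqs

contains-132⇔ : ∀ {α} → Contains α p132 ⇔ Has132 α
contains-132⇔ = mk⇔ to from
  where
  to : ∀ {α} → Contains α p132 → Has132 α
  to (a ∷ b ∷ c ∷ [] , abc⊆ , refl , iso) =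
    a , b , c , abc⊆ ,
    Equivalence.from (iso fzero (fsuc (fsuc fzero))) (from-yes (1 <? 2)) ,
    Equivalence.from (iso (fsuc (fsuc fzero)) (fsuc fzero)) (from-yes (2 <? 3))
  from : ∀ {α} → Has132 α → Contains α p132
  from (a , b , c , abc⊆ , a<c , c<b) = a ∷ b ∷ c ∷ [] , abc⊆ ,
    orderIso₃ (inj₁ (<-trans a<c c<b , from-yes (1 <? 3)))
              (inj₁ (a<c , from-yes (1 <? 2)))
              (inj₂ (c<b , from-yes (2 <? 3)))

contains-213⇔ : ∀ {α} → Contains α p213 ⇔ Has213 α
contains-213⇔ = mk⇔ to from
  where
  to : ∀ {α} → Contains α p213 → Has213 α
  to (a ∷ b ∷ c ∷ [] , abc⊆ , refl , iso) =
    a , b , c , abc⊆ ,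
    Equivalence.from (iso (fsuc fzero) fzero) (from-yes (1 <? 2)) ,
    Equivalence.from (iso fzero (fsuc (fsuc fzero))) (from-yes (2 <? 3))
  from : ∀ {α} → Has213 α → Contains α p213
  from (a , b , c , abc⊆ , b<a , a<c) = a ∷ b ∷ c ∷ [] , abc⊆ ,
    orderIso₃ (inj₂ (b<a , from-yes (1 <? 2)))
              (inj₁ (a<c , from-yes (2 <? 3)))
              (inj₁ (<-trans b<a a<c , from-yes (1 <? 3)))

lookup-decreasing : ∀ {xs} → AllPairs _>_ xs →
  ∀ (i j : Fin (length xs)) → (lookup xs i < lookup xs j) ⇔ (toℕ j < toℕ i)
lookup-decreasing {xs} xs↓ i j = mk⇔ to (AllPairs-lookup xs↓ j i)
  where
  to : lookup xs i < lookup xs j → toℕ j < toℕ i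
  to xᵢ<xⱼ with <-cmp (toℕ i) (toℕ j)
  ... | tri< i<j _ _ = ⊥-elim (<-asym xᵢ<xⱼ (AllPairs-lookup xs↓ i j i<j))
  ... | tri≈ _ i≡j _ = ⊥-elim (<-irrefl (cong (lookup xs) (toℕ-injective i≡j)) xᵢ<xⱼ)
  ... | tri> _ _ j<i = j<i

orderIso-decreasing : ∀ {σ τ} → AllPairs _>_ τ →
  OrderIso σ τ ⇔ (length σ ≡ length τ × AllPairs _>_ σ)
orderIso-decreasing {σ} {τ} τ↓ = mk⇔ to from
  where
  cast-< : ∀ eq (i j : Fin (length σ)) → (toℕ i < toℕ j) ⇔ (toℕ (cast eq i) < toℕ (cast eq j))
  cast-< eq i j rewrite toℕ-cast eq i | toℕ-cast eq j = ⇔-id _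
  to : OrderIso σ τ → length σ ≡ length τ × AllPairs _>_ σ
  to (eq , iso) = eq , AllPairs-tabulate σ λ i j i<j →
    Equivalence.from (iso j i)
      (Equivalence.from (lookup-decreasing τ↓ (cast eq j) (cast eq i)) (Equivalence.to (cast-< eq i j) i<j))
  from : length σ ≡ length τ × AllPairs _>_ σ → OrderIso σ τ
  from (eq , σ↓) = eq , λ i j →
    ⇔-sym (lookup-decreasing τ↓ (cast eq i) (cast eq j)) ⇔-∘ (cast-< eq j i ⇔-∘ lookup-decreasing σ↓ i j)

decPat-decreasing : ∀ k → AllPairs _>_ (decPat k)
decPat-decreasing zero    = []
decPat-decreasing (suc k) = All-map⁺ (All.map s≤s (below k)) ∷ decPat-decreasing k
  where
  below : ∀ k → All (_< k) (downFrom k)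
  below zero    = []
  below (suc k) = n<1+n k ∷ All.map m<n⇒m<1+n (below k)

length-decPat : ∀ k → length (decPat k) ≡ k
length-decPat k = trans (length-map suc (downFrom k)) (length-downFrom k)

contains-decPat⇔ : ∀ {k α} → Contains α (decPat k) ⇔ HasDecreasing k α
contains-decPat⇔ {k} = mk⇔ to from
  where
  iso⇔ : ∀ {σ} → OrderIso σ (decPat k) ⇔ (length σ ≡ length (decPat k) × AllPairs _>_ σ)
  iso⇔ = orderIso-decreasing (decPat-decreasing k)
  to : ∀ {α} → Contains α (decPat k) → HasDecreasing k α
  to (σ , σ⊆ , iso) with Equivalence.to iso⇔ iso
  ... | eq , σ↓ = σ , σ⊆ , σ↓ , trans eq (length-decPat k)
  from : ∀ {α} → HasDecreasing k α → Contains α (decPat k)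
  from (σ , σ⊆ , σ↓ , eq) = σ , σ⊆ , Equivalence.from iso⇔ (trans eq (sym (length-decPat k)) , σ↓)

InClass′ : ℕ → ℕ → List ℕ → Set
InClass′ k n α = α ↭ block 0 n × ¬ Has132 α × ¬ Has213 α × ¬ HasDecreasing k α

inClass⇔ : ∀ {k n α} → InClass k n α ⇔ InClass′ k n α
inClass⇔ {k} {n} = mk⇔
  (λ (α↭ , ¬132 , ¬213 , ¬dec) →
    subst (_ ↭_) (map-suc-upTo n) α↭ ,
    ¬132 ∘ from contains-132⇔ , ¬213 ∘ from contains-213⇔ , ¬dec ∘ from contains-decPat⇔)
  (λ (α↭ , ¬132 , ¬213 , ¬dec) →
    subst (_ ↭_) (sym (map-suc-upTo n)) α↭ ,
    ¬132 ∘ to contains-132⇔ , ¬213 ∘ to contains-213⇔ , ¬dec ∘ to contains-decPat⇔)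
  where open Equivalence

module _ {t : ℕ} {X β : List ℕ}
         (X↑ : AllPairs _<_ X) (t<X : All (t <_) X) (β≤t : All (_≤ t) β) where

  private
    X≮β : ∀ {x y} → t < x → y ≤ t → ¬ x < y
    X≮β t<x y≤t x<y = <-asym (<-≤-trans x<y y≤t) t<x

  ++-avoids132 : ¬ Has132 β → ¬ Has132 (X ++ β)
  ++-avoids132 ¬132 (a , b , c , abc⊆ , a<c , c<b) with ⊆-++-split X abc⊆
  ... | [] , _ , refl , _ , σ₂⊆ = ¬132 (a , b , c , σ₂⊆ , a<c , c<b)
  ... | _ ∷ [] , _ , refl , σ₁⊆ , σ₂⊆ =
    X≮β (All.head (All-resp-⊆ σ₁⊆ t<X)) (All.head (All.tail (All-resp-⊆ σ₂⊆ β≤t))) a<c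
  ... | _ ∷ _ ∷ [] , _ , refl , σ₁⊆ , σ₂⊆ =
    X≮β (All.head (All-resp-⊆ σ₁⊆ t<X)) (All.head (All-resp-⊆ σ₂⊆ β≤t)) a<c
  ... | _ ∷ _ ∷ _ ∷ [] , _ , refl , σ₁⊆ , _ =
    <-asym c<b (All.head (AllPairs.head (AllPairs.tail (AllPairs-resp-⊆ σ₁⊆ X↑))))

  ++-avoids213 : ¬ Has213 β → ¬ Has213 (X ++ β)
  ++-avoids213 ¬213 (a , b , c , abc⊆ , b<a , a<c) with ⊆-++-split X abc⊆
  ... | [] , _ , refl , _ , σ₂⊆ = ¬213 (a , b , c , σ₂⊆ , b<a , a<c)
  ... | _ ∷ [] , _ , refl , σ₁⊆ , σ₂⊆ =
    X≮β (All.head (All-resp-⊆ σ₁⊆ t<X)) (All.head (All.tail (All-resp-⊆ σ₂⊆ β≤t))) a<c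
  ... | _ ∷ _ ∷ [] , _ , refl , σ₁⊆ , σ₂⊆ =
    X≮β (All.head (All-resp-⊆ σ₁⊆ t<X)) (All.head (All-resp-⊆ σ₂⊆ β≤t)) a<c
  ... | _ ∷ _ ∷ _ ∷ [] , _ , refl , σ₁⊆ , _ =
    <-asym b<a (All.head (AllPairs.head (AllPairs-resp-⊆ σ₁⊆ X↑)))

decreasing-tail-⊆ : ∀ {X β x σ} → AllPairs _<_ X → AllPairs _>_ (x ∷ σ) →
  x ∷ σ ⊆ X ++ β → σ ⊆ β
decreasing-tail-⊆ {X} X↑ xσ↓ xσ⊆ with ⊆-++-split X xσ⊆
... | [] , _ , refl , _ , σ₂⊆ = ∷ˡ⁻ σ₂⊆
... | _ ∷ [] , _ , refl , _ , σ₂⊆ = σ₂⊆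
... | _ ∷ _ ∷ _ , _ , refl , σ₁⊆ , _ =
  ⊥-elim (<-asym (All.head (AllPairs.head xσ↓))
                 (All.head (AllPairs.head (AllPairs-resp-⊆ σ₁⊆ X↑))))

++-avoidsDecreasing : ∀ {k X β} → AllPairs _<_ X →
  ¬ HasDecreasing (suc k) β → ¬ HasDecreasing (suc (suc k)) (X ++ β)
++-avoidsDecreasing X↑ ¬dec (_ ∷ σ , xσ⊆ , xσ↓ , eq) =
  ¬dec (σ , decreasing-tail-⊆ X↑ xσ↓ xσ⊆ , AllPairs.tail xσ↓ , suc-injective eq)

sum-upTo-suc : ∀ (h : ℕ → ℕ) u → sum (map h (upTo (suc u))) ≡ sum (map h (upTo u)) + h u
sum-upTo-suc h u = begin
  sum (map h (upTo (suc u)))               ≡⟨ cong (sum ∘ map h) (applyUpTo-∷ʳ (λ i → i) u) ⟨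
  sum (map h (upTo u ++ [ u ]))            ≡⟨ cong sum (map-++ h (upTo u) [ u ]) ⟩
  sum (map h (upTo u) ++ [ h u ])          ≡⟨ sum-++ (map h (upTo u)) [ h u ] ⟩
  sum (map h (upTo u)) + (h u + 0)         ≡⟨ cong (sum (map h (upTo u)) +_) (+-identityʳ (h u)) ⟩
  sum (map h (upTo u)) + h u               ∎
  where open ≡-Reasoning

extensions : (ℕ → List (List ℕ)) → ℕ → ℕ → List (List ℕ)
extensions f n zero    = []
extensions f n (suc u) = extensions f n u ++ map (block u (n ∸ u) ++_) (f u)

module _ (f : ℕ → List (List ℕ)) (n : ℕ) where

  ∈-extensions⁻ : ∀ u {α} → α ∈ extensions f n u →
    ∃ λ t → t < u × ∃ λ β → β ∈ f t × α ≡ block t (n ∸ t) ++ β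
  ∈-extensions⁻ (suc u) α∈ with ∈-++⁻ (extensions f n u) α∈
  ... | inj₁ α∈ᵤ with ∈-extensions⁻ u α∈ᵤ
  ...   | t , t<u , β , β∈ , refl = t , m<n⇒m<1+n t<u , β , β∈ , refl
  ∈-extensions⁻ (suc u) α∈ | inj₂ α∈map with ∈-map⁻ (block u (n ∸ u) ++_) α∈map
  ...   | β , β∈ , refl = u , ≤-refl , β , β∈ , refl

  ∈-extensions⁺ : ∀ u {t β} → t < u → β ∈ f t → block t (n ∸ t) ++ β ∈ extensions f n u
  ∈-extensions⁺ (suc u) {t} t<1+u β∈ with m<1+n⇒m<n∨m≡n t<1+u
  ... | inj₁ t<u  = ∈-++⁺ˡ (∈-extensions⁺ u t<u β∈)
  ... | inj₂ refl = ∈-++⁺ʳ (extensions f n u) (∈-map⁺ (block t (n ∸ t) ++_) β∈)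

  head-block-++ : ∀ {t} β → t < n → head (block t (n ∸ t) ++ β) ≡ just (suc t)
  head-block-++ {t} β t<n with n ∸ t | m<n⇒0<n∸m t<n
  ... | suc _ | _ = refl

  extensions-unique : ∀ u → u ≤ n → (∀ t → Unique (f t)) → Unique (extensions f n u)
  extensions-unique zero    _   _       = []
  extensions-unique (suc u) u<n f-unique =
    Unique.++⁺ (extensions-unique u (<⇒≤ u<n) f-unique)
               (Unique.map⁺ (++-cancelˡ (block u (n ∸ u)) _ _) (f-unique u))
               disjoint
    where
    disjoint : ∀ {α} → α ∈ extensions f n u × α ∈ map (block u (n ∸ u) ++_) (f u) → ⊥
    disjoint (α∈ , α∈map) with ∈-extensions⁻ u α∈ | ∈-map⁻ (block u (n ∸ u) ++_) α∈map
    ... | t , t<u , β , _ , refl | γ , _ , eq =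
      <-irrefl (suc-injective (just-injective (begin
        just (suc t)                         ≡⟨ head-block-++ β (<-trans t<u u<n) ⟨
        head (block t (n ∸ t) ++ β)          ≡⟨ cong head eq ⟩
        head (block u (n ∸ u) ++ γ)          ≡⟨ head-block-++ γ u<n ⟩
        just (suc u)                         ∎))) t<u
      where open ≡-Reasoning

  length-extensions : ∀ u → length (extensions f n u) ≡ sum (map (length ∘ f) (upTo u))
  length-extensions zero    = refl
  length-extensions (suc u) = begin
    length (extensions f n u ++ map (block u (n ∸ u) ++_) (f u))
      ≡⟨ length-++ (extensions f n u) ⟩
    length (extensions f n u) + length (map (block u (n ∸ u) ++_) (f u))
      ≡⟨ cong₂ _+_ (length-extensions u) (length-map _ (f u)) ⟩
    sum (map (length ∘ f) (upTo u)) + length (f u)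
      ≡⟨ sum-upTo-suc (length ∘ f) u ⟨
    sum (map (length ∘ f) (upTo (suc u)))  ∎
    where open ≡-Reasoning

blockPerms : ℕ → ℕ → List (List ℕ)
blockPerms zero    m       = [] ∷ []
blockPerms (suc n) zero    = []
blockPerms (suc n) (suc m) = extensions (λ t → blockPerms t m) (suc n) (suc n)

blockPerms-unique : ∀ n m → Unique (blockPerms n m)
blockPerms-unique zero    m       = [] ∷ []
blockPerms-unique (suc n) zero    = []
blockPerms-unique (suc n) (suc m) =
  extensions-unique (λ t → blockPerms t m) (suc n) (suc n) ≤-refl (λ t → blockPerms-unique t m)

blockPerms-sound : ∀ m n {α} → α ∈ blockPerms n m → InClass′ (suc m) n α
blockPerms-sound m       zero    (here refl) =
  ↭-refl , (λ { (_ , _ , _ , () , _) }) , (λ { (_ , _ , _ , () , _) }) , λ { (_ , [] , _ , ()) }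
blockPerms-sound (suc m) (suc n) α∈ with ∈-extensions⁻ (λ t → blockPerms t m) (suc n) (suc n) α∈
... | t , t<n , β , β∈ , refl with blockPerms-sound m t β∈
... | β↭ , ¬132 , ¬213 , ¬dec =
  ↭-trans (↭-++⁺ˡ (block t (suc n ∸ t)) β↭) (block-split-↭ (<⇒≤ t<n)) ,
  ++-avoids132 X↑ (block-lower t _) β≤t ¬132 ,
  ++-avoids213 X↑ (block-lower t _) β≤t ¬213 ,
  ++-avoidsDecreasing X↑ ¬dec
  where
  X↑ : AllPairs _<_ (block t (suc n ∸ t))
  X↑ = block-increasing t (suc n ∸ t)
  β≤t : All (_≤ t) β
  β≤t = All-resp-↭ (↭-sym β↭) (block-upper 0 t)

split-after-first : ∀ v rest → ¬ Has213 (v ∷ rest) → All (v ≢_) rest →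
  ∃₂ λ A B → rest ≡ A ++ B × All (v <_) A × All (_< v) B
split-after-first v []      _    _             = [] , [] , refl , [] , []
split-after-first v (z ∷ r) ¬213 (v≢z ∷ v≢r) with <-cmp z v
... | tri< z<v _ _ = [] , z ∷ r , refl , [] , z<v ∷ All.tabulate below
  where
  below : ∀ {x} → x ∈ r → x < v
  below x∈r = ≤∧≢⇒< (≮⇒≥ λ v<x → ¬213 (v , z , _ , refl ∷ refl ∷ from∈ x∈r , z<v , v<x))
                    (≢-sym (All.lookup v≢r x∈r))
... | tri≈ _ z≡v _ = ⊥-elim (v≢z (sym z≡v))
... | tri> _ _ v<z with split-after-first v r (¬213 ∘ Has213-mono (refl ∷ z ∷ʳ ⊆-refl)) v≢r
...   | A , B , refl , v<A , B<v = z ∷ A , B , refl , v<z ∷ v<A , B<v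

noDescent⇒increasing : ∀ {xs} → Unique xs → (∀ {x y} → x ∷ y ∷ [] ⊆ xs → ¬ y < x) →
  AllPairs _<_ xs
noDescent⇒increasing {[]}     _                   _         = []
noDescent⇒increasing {x ∷ xs} (x≢xs ∷ xs-unique) noDescent =
  All.tabulate (λ y∈ → ≤∧≢⇒< (≮⇒≥ (noDescent (refl ∷ from∈ y∈))) (All.lookup x≢xs y∈)) ∷
  noDescent⇒increasing xs-unique (noDescent ∘ (x ∷ʳ_))

top-block-split : ∀ {n t A B} → t ≤ n → All (suc t <_) A → All (_< suc t) B →
  suc t ∷ A ++ B ↭ block 0 (suc n) → suc t ∷ A ↭ block t (suc n ∸ t) × B ↭ block 0 t
top-block-split {n} {t} t≤n t<A B≤t α↭ =
  ↭-partition (t <?_) (≤-refl ∷ All.map <⇒≤ t<A) (All.map (≤⇒≯ ∘ s≤s⁻¹) B≤t)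
    (block-lower t (suc n ∸ t)) (All.map ≤⇒≯ (block-upper 0 t))
    (↭-trans α↭ (↭-sym (block-split-↭ (m≤n⇒m≤1+n t≤n))))

peel-top-block : ∀ {m n t rest} → t ≤ n → InClass′ (suc (suc m)) (suc n) (suc t ∷ rest) →
  ∃ λ β → suc t ∷ rest ≡ block t (suc n ∸ t) ++ β × InClass′ (suc m) t β
peel-top-block {n = n} {t} {rest} t≤n (α↭ , ¬132 , ¬213 , ¬dec)
  with α-unique ← Unique-resp-↭ (↭-sym α↭) (block-unique 0 (suc n))
  with split-after-first (suc t) rest ¬213 (AllPairs.head α-unique)
... | A , B , refl , t<A , B≤t with top-block-split t≤n t<A B≤t α↭
...   | top↭ , B↭ = B , cong (_++ B) top≡ ,
  B↭ , ¬132 ∘ Has132-mono B⊆ , ¬213 ∘ Has213-mono B⊆ , ¬dec ∘ prepend-top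
  where
  A⊆ : A ⊆ A ++ B
  A⊆ = ⊆-++⁺ʳ B ⊆-refl
  B⊆ : B ⊆ suc t ∷ A ++ B
  B⊆ = suc t ∷ʳ ⊆-++⁺ˡ A ⊆-refl
  A↑ : AllPairs _<_ A
  A↑ = noDescent⇒increasing (AllPairs-resp-⊆ A⊆ (AllPairs.tail α-unique))
    λ xy⊆ y<x → ¬132 (suc t , _ , _ , refl ∷ ⊆-trans xy⊆ A⊆ ,
                      All.head (All-resp-⊆ (∷ˡ⁻ xy⊆) t<A) , y<x)
  top≡ : suc t ∷ A ≡ block t (suc n ∸ t)
  top≡ = ↭-increasing⇒≡ (t<A ∷ A↑) (block-increasing t (suc n ∸ t)) top↭
  prepend-top : ∀ {k} → HasDecreasing k B → HasDecreasing (suc k) (suc t ∷ A ++ B)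
  prepend-top (σ , σ⊆ , σ↓ , eq) =
    suc t ∷ σ , refl ∷ ⊆-trans σ⊆ (⊆-++⁺ˡ A ⊆-refl) , All-resp-⊆ σ⊆ B≤t ∷ σ↓ , cong suc eq

blockPerms-complete : ∀ m n {α} → InClass′ (suc m) n α → α ∈ blockPerms n m
blockPerms-complete m zero {α} (α↭ , _) rewrite ↭-empty-inv α↭ = here refl
blockPerms-complete m (suc n) {[]} (α↭ , _) = ⊥-elim (¬x∷xs↭[] (↭-sym α↭))
blockPerms-complete zero (suc n) {v ∷ _} (_ , _ , _ , ¬dec) =
  ⊥-elim (¬dec ([ v ] , refl ∷ minimum _ , [] ∷ [] , refl))
blockPerms-complete (suc m) (suc n) {zero ∷ _} (α↭ , _) =
  ⊥-elim (<-irrefl refl (All.head (All-resp-↭ (↭-sym α↭) (block-lower 0 (suc n)))))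
blockPerms-complete (suc m) (suc n) {suc t ∷ _} cls@(α↭ , _)
  with t≤n ← s≤s⁻¹ (All.head (All-resp-↭ (↭-sym α↭) (block-upper 0 (suc n))))
  with peel-top-block t≤n cls
... | β , α≡ , β-class = subst (_∈ blockPerms (suc n) (suc m)) (sym α≡)
  (∈-extensions⁺ (λ t → blockPerms t m) (suc n) (suc n) (s≤s t≤n) (blockPerms-complete m t β-class))

sum-upTo-concentrated : ∀ (h : ℕ → ℕ) → (∀ j → h (suc j) ≡ 0) →
  ∀ u → sum (map h (upTo (suc u))) ≡ h 0
sum-upTo-concentrated h h-zero zero    = +-identityʳ (h 0)
sum-upTo-concentrated h h-zero (suc u) = begin
  sum (map h (upTo (suc (suc u))))       ≡⟨ sum-upTo-suc h (suc u) ⟩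
  sum (map h (upTo (suc u))) + h (suc u) ≡⟨ cong₂ _+_ (sum-upTo-concentrated h h-zero u) (h-zero u) ⟩
  h 0 + 0                                ≡⟨ +-identityʳ (h 0) ⟩
  h 0                                    ∎
  where open ≡-Reasoning

sum-binomial-pascal : ∀ n u →
  sum (map (suc n C_) (upTo (suc u))) ≡ sum (map (n C_) (upTo (suc u))) + sum (map (n C_) (upTo u))
sum-binomial-pascal n zero    = refl
sum-binomial-pascal n (suc u) = begin
  sum (map (suc n C_) (upTo (suc (suc u))))
    ≡⟨ sum-upTo-suc (suc n C_) (suc u) ⟩
  sum (map (suc n C_) (upTo (suc u))) + suc n C suc u
    ≡⟨ cong₂ _+_ (sum-binomial-pascal n u) (trans (sym (nCk+nC[k+1]≡[n+1]C[k+1] n u)) (+-comm (n C u) _)) ⟩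
  (S (suc u) + S u) + (n C suc u + n C u)
    ≡⟨ interchange +-commutativeSemigroup (S (suc u)) (S u) (n C suc u) (n C u) ⟩
  (S (suc u) + n C suc u) + (S u + n C u)
    ≡⟨ cong₂ _+_ (sum-upTo-suc (n C_) (suc u)) (sum-upTo-suc (n C_) u) ⟨
  S (suc (suc u)) + S (suc u)
    ∎
  where
  open ≡-Reasoning
  S : ℕ → ℕ
  S v = sum (map (n C_) (upTo v))

count : ℕ → ℕ → ℕ
count n m = length (blockPerms n m)

sum-count : ∀ n m → sum (map (λ t → count t m) (upTo (suc n))) ≡ sum (map (n C_) (upTo (suc m)))
sum-count zero    m       = sym (sum-upTo-concentrated (0 C_) (λ _ → refl) m)
sum-count (suc n) zero    =
  trans (sum-upTo-suc (λ t → count t 0) (suc n)) (trans (+-identityʳ _) (sum-count n zero))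
sum-count (suc n) (suc m) = begin
  sum (map (λ t → count t (suc m)) (upTo (suc (suc n))))
    ≡⟨ sum-upTo-suc (λ t → count t (suc m)) (suc n) ⟩
  sum (map (λ t → count t (suc m)) (upTo (suc n))) + count (suc n) (suc m)
    ≡⟨ cong₂ _+_ (sum-count n (suc m))
                 (trans (length-extensions (λ t → blockPerms t m) (suc n) (suc n)) (sum-count n m)) ⟩
  sum (map (n C_) (upTo (suc (suc m)))) + sum (map (n C_) (upTo (suc m)))
    ≡⟨ sum-binomial-pascal n (suc m) ⟨
  sum (map (suc n C_) (upTo (suc (suc m))))
    ∎
  where open ≡-Reasoning

count-formula : ∀ n m → count n (suc m) ≡ rhs (suc (suc m)) n
count-formula zero    m = sym (sum-upTo-concentrated (binomPred 0) (λ _ → refl) m)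
count-formula (suc n) m = trans (length-extensions (λ t → blockPerms t m) (suc n) (suc n)) (sum-count n m)

corollary1 : ∀ (k : ℕ) → k ≥ 2 → ∀ (n : ℕ) →
    ∃ λ (L : List (List ℕ)) → Unique L × (∀ α → (α ∈ L) ⇔ InClass k n α) × length L ≡ rhs k n
corollary1 (suc zero) (s≤s ()) n
corollary1 (suc (suc m)) _ n =
  blockPerms n (suc m) ,
  blockPerms-unique n (suc m) ,
  (λ α → ⇔-sym inClass⇔ ⇔-∘ mk⇔ (blockPerms-sound (suc m) n) (blockPerms-complete (suc m) n)) ,
  count-formula n m
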